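{- Let $j,r,k$ be non-negative integers with $j+r\le k$. Let $\mathcal{Y}'_{j,r,k}$ be the set of frequency sequences $(f_i)_{i\ge0}$ such that $f_i+f_{i+1}\le k$ for all $i\ge0$, $f_0\in\{\ell+\max\{\ell-(j-r),0\} : 0\le\ell\le j\}$, and whenever $f_u+f_{u+1}=k$ the integer $uf_u+(u+1)f_{u+1}$ has the same parity as $k+r-j$. Let $\mathcal{Z}'_{j,r,k}$ be the set of frequency sequences $(f_i)_{i\ge0}$ such that $f_i+f_{i+1}\le k$ for all $i\ge0$, $f_0\le j-\max\{f_0+f_1-(k-r),0\}$, and whenever $f_u+f_{u+1}=k$ the integer $uf_u+(u+1)f_{u+1}$ has the same parity as $k+r-j$. Then there exists a size-preserving bijection from $\mathcal{Y}'_{j,r,k}$ to $\mathcal{Z}'_{j,r,k}$.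
   Context: A frequency sequence is a sequence $(f_i)_{i\ge0}$ of non-negative integers with finitely many nonzero entries; its size is $|f|=\sum_{i\ge0}if_i$. -}

module Defs where

open import Level using (0ℓ)
open import Data.Nat using (ℕ; zero; suc; _+_; _*_; _∸_; _≤_; _%_)
open import Data.List using (List; map; upTo)
open import Data.Nat.ListAction using (sum)
open import Data.Product using (Σ; ∃; _×_; _,_; proj₁)
open import Relation.Binary.PropositionalEquality using (_≡_; refl; sym; trans)
open import Relation.Binary.Bundles using (Setoid)
open import Relation.Binary.Structures using (IsEquivalence)
open import Function.Bundles using (Bijection)

record FreqSeq : Set where
  field
    seq    : ℕ → ℕ
    bound  : ℕ
    vanish : ∀ i → bound ≤ i → seq i ≡ 0
open FreqSeq public

size : FreqSeq → ℕ
size f = sum (map (λ i → i * seq f i) (upTo (bound f)))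

_≈F_ : FreqSeq → FreqSeq → Set
f ≈F g = ∀ i → seq f i ≡ seq g i

SameParity : ℕ → ℕ → Set
SameParity a b = a % 2 ≡ b % 2

SumBound : ℕ → FreqSeq → Set
SumBound k f = ∀ i → seq f i + seq f (suc i) ≤ k

ParityCond : ℕ → ℕ → ℕ → FreqSeq → Set
ParityCond j r k f = ∀ u → seq f u + seq f (suc u) ≡ k →
  SameParity (u * seq f u + suc u * seq f (suc u)) ((k + r) ∸ j)

-- 𝒴'_{j,r,k}: f_0 ∈ { ℓ + max(ℓ - (j - r), 0) : 0 ≤ ℓ ≤ j }
-- (max(ℓ - (j - r), 0) = (ℓ + r) ∸ j in ℕ)
InY : ℕ → ℕ → ℕ → FreqSeq → Set
InY j r k f =
  SumBound k f ×
  (∃ λ ℓ → ℓ ≤ j × seq f 0 ≡ ℓ + ((ℓ + r) ∸ j)) ×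
  ParityCond j r k f

-- 𝒵'_{j,r,k}: f_0 ≤ j - max(f_0 + f_1 - (k - r), 0)
-- (equivalently f_0 + max(...) ≤ j, with max(...) = (f_0 + f_1) ∸ (k ∸ r) as r ≤ k)
InZ : ℕ → ℕ → ℕ → FreqSeq → Set
InZ j r k f =
  SumBound k f ×
  seq f 0 + ((seq f 0 + seq f 1) ∸ (k ∸ r)) ≤ j ×
  ParityCond j r k f

SubSetoid : (FreqSeq → Set) → Setoid 0ℓ 0ℓ
SubSetoid P = record
  { Carrier = Σ FreqSeq P
  ; _≈_ = λ x y → proj₁ x ≈F proj₁ y
  ; isEquivalence = record
      { refl = λ i → refl
      ; sym = λ p i → sym (p i)
      ; trans = λ p q i → trans (p i) (q i)
      }
  }

𝒴' : ℕ → ℕ → ℕ → Setoid 0ℓ 0ℓ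
𝒴' j r k = SubSetoid (InY j r k)

𝒵' : ℕ → ℕ → ℕ → Setoid 0ℓ 0ℓ
𝒵' j r k = SubSetoid (InZ j r k)

-- Only f₀ differs between the two sides, and it carries weight 0 in the size,
-- so the bijection replaces f₀ = ℓ + max(ℓ − (j − r), 0) by ℓ and keeps the
-- tail. Both bounds on f₀ + f₁ then unfold to ℓ + f₁ ≤ k and
-- 2ℓ + f₁ + r ≤ j + k. The parity condition at u = 0 only involves f₁: it is
-- inherited whenever the old and new f₀ agree, and when they differ the
-- equation f₀ + f₁ = k forces f₁ ≡ k + r − j (mod 2) by itself.
module Submission where

open import Defs
open import Data.Nat using (ℕ; zero; suc; _+_; _*_; _∸_; _≤_; _<_; _%_; s≤s)
open import Data.Nat.Properties
open import Data.Nat.DivMod using ([m+kn]%n≡m%n)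
open import Data.Nat.ListAction using (sum)
open import Data.Nat.ListAction.Properties using (sum-++)
open import Data.Nat.Tactic.RingSolver using (solve-∀)
open import Data.List using (map; upTo; [_]; _++_)
open import Data.List.Properties using (map-cong; map-++; upTo-∷ʳ)
open import Data.Product using (Σ; _×_; _,_; proj₁; proj₂)
open import Data.Sum using (inj₁; inj₂)
open import Function using (_∘_)
open import Function.Bundles using (Bijection; Inverse; _⇔_; mk⇔; Equivalence)
open import Function.Definitions using (Injective)
open import Function.Properties.Inverse using (Inverse⇒Bijection)
open import Relation.Binary.Definitions using (tri<; tri≈; tri>)
open import Relation.Binary.PropositionalEquality hiding ([_])
open import Relation.Nullary using (contradiction)

open Equivalence using (to; from)

sum-map-upTo-suc : ∀ (h : ℕ → ℕ) n →
  sum (map h (upTo (suc n))) ≡ sum (map h (upTo n)) + h n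
sum-map-upTo-suc h n = begin
  sum (map h (upTo (suc n)))        ≡⟨ cong (sum ∘ map h) (upTo-∷ʳ n) ⟨
  sum (map h (upTo n ++ [ n ]))     ≡⟨ cong sum (map-++ h (upTo n) [ n ]) ⟩
  sum (map h (upTo n) ++ [ h n ])   ≡⟨ sum-++ (map h (upTo n)) [ h n ] ⟩
  sum (map h (upTo n)) + (h n + 0)  ≡⟨ cong (sum (map h (upTo n)) +_) (+-identityʳ (h n)) ⟩
  sum (map h (upTo n)) + h n        ∎
  where open ≡-Reasoning

withHead : ℕ → FreqSeq → FreqSeq
withHead a f = record { seq = entry ; bound = suc (bound f) ; vanish = entry-vanish }
  where
  entry : ℕ → ℕ
  entry zero    = a
  entry (suc i) = seq f (suc i)
  entry-vanish : ∀ i → suc (bound f) ≤ i → entry i ≡ 0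
  entry-vanish (suc i) (s≤s b≤i) = vanish f (suc i) (m≤n⇒m≤1+n b≤i)

size-withHead : ∀ a f → size (withHead a f) ≡ size f
size-withHead a f = begin
  size (withHead a f)             ≡⟨ cong sum (map-cong weight-agrees (upTo (suc b))) ⟩
  sum (map h (upTo (suc b)))      ≡⟨ sum-map-upTo-suc h b ⟩
  sum (map h (upTo b)) + b * seq f b
                                  ≡⟨ cong (λ z → sum (map h (upTo b)) + b * z) (vanish f b ≤-refl) ⟩
  sum (map h (upTo b)) + b * 0    ≡⟨ cong (sum (map h (upTo b)) +_) (*-zeroʳ b) ⟩
  sum (map h (upTo b)) + 0        ≡⟨ +-identityʳ _ ⟩
  size f                          ∎
  where
  open ≡-Reasoning
  b : ℕ
  b = bound f
  h : ℕ → ℕ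
  h i = i * seq f i
  weight-agrees : ∀ i → i * seq (withHead a f) i ≡ h i
  weight-agrees zero    = refl
  weight-agrees (suc i) = refl

m+[n∸o]≤p⇔ : ∀ m n o p → m + (n ∸ o) ≤ p ⇔ (m ≤ p × m + n ≤ p + o)
m+[n∸o]≤p⇔ m n o p = mk⇔ ⇒ ⇐
  where
  open ≤-Reasoning
  ⇒ : m + (n ∸ o) ≤ p → m ≤ p × m + n ≤ p + o
  ⇒ le = m+n≤o⇒m≤o m le , (begin
    m + n                ≤⟨ +-monoʳ-≤ m (m≤n+m∸n n o) ⟩
    m + (o + (n ∸ o))    ≡⟨ cong (m +_) (+-comm o (n ∸ o)) ⟩
    m + ((n ∸ o) + o)    ≡⟨ +-assoc m (n ∸ o) o ⟨
    m + (n ∸ o) + o      ≤⟨ +-monoˡ-≤ o le ⟩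
    p + o                ∎)
  ⇐ : m ≤ p × m + n ≤ p + o → m + (n ∸ o) ≤ p
  ⇐ (m≤p , m+n≤p+o) with ≤-total o n
  ... | inj₁ o≤n = begin
    m + (n ∸ o)          ≡⟨ +-∸-assoc m o≤n ⟨
    (m + n) ∸ o          ≤⟨ m≤n+o⇒m∸n≤o (m + n) o (subst (m + n ≤_) (+-comm p o) m+n≤p+o) ⟩
    p                    ∎
  ... | inj₂ n≤o = begin
    m + (n ∸ o)          ≡⟨ cong (m +_) (m≤n⇒m∸n≡0 n≤o) ⟩
    m + 0                ≡⟨ +-identityʳ m ⟩
    m                    ≤⟨ m≤p ⟩
    p                    ∎

module _ (j r : ℕ) where

  yHead : ℕ → ℕ
  yHead ℓ = ℓ + ((ℓ + r) ∸ j)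

  yHead+x≡ : ∀ ℓ x → yHead ℓ + x ≡ (ℓ + x) + ((ℓ + r) ∸ j)
  yHead+x≡ ℓ x = swap ℓ ((ℓ + r) ∸ j) x
    where
    swap : ∀ a b c → a + b + c ≡ a + c + b
    swap = solve-∀

  yHead-mono-< : ∀ {ℓ m} → ℓ < m → yHead ℓ < yHead m
  yHead-mono-< ℓ<m = +-mono-<-≤ ℓ<m (∸-monoˡ-≤ j (+-monoˡ-≤ r (<⇒≤ ℓ<m)))

  yHead-injective : Injective _≡_ _≡_ yHead
  yHead-injective {ℓ} {m} eq with <-cmp ℓ m
  ... | tri< ℓ<m _ _ = contradiction eq (<⇒≢ (yHead-mono-< ℓ<m))
  ... | tri≈ _ ℓ≡m _ = ℓ≡m
  ... | tri> _ _ m<ℓ = contradiction (sym eq) (<⇒≢ (yHead-mono-< m<ℓ))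

  yHead≡id : ∀ {ℓ} → ℓ + r ≤ j → yHead ℓ ≡ ℓ
  yHead≡id {ℓ} ℓ+r≤j = trans (cong (ℓ +_) (m≤n⇒m∸n≡0 ℓ+r≤j)) (+-identityʳ ℓ)

  yHead+x≤ℓ+x⇒yHead≡id : ∀ {ℓ x} → yHead ℓ + x ≤ ℓ + x → yHead ℓ ≡ ℓ
  yHead+x≤ℓ+x⇒yHead≡id {ℓ} {x} le = ≤-antisym (+-cancelʳ-≤ x _ _ le) (m≤m+n ℓ _)

  -- With t = ℓ + r ∸ j we have j + t = ℓ + r, so (f₀ + f₁ + r) ∸ j = f₁ + 2t.
  yHead+x-parity : ∀ {ℓ x m} → j ≤ ℓ + r → yHead ℓ + x ≡ m →
    SameParity x ((m + r) ∸ j)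
  yHead+x-parity {ℓ} {x} j≤ℓ+r refl = sym (begin
    ((yHead ℓ + x + r) ∸ j) % 2   ≡⟨ cong (λ z → (z ∸ j) % 2) rearrange ⟩
    ((j + (x + t * 2)) ∸ j) % 2   ≡⟨ cong (_% 2) (m+n∸m≡n j (x + t * 2)) ⟩
    (x + t * 2) % 2               ≡⟨ [m+kn]%n≡m%n x t 2 ⟩
    x % 2                         ∎)
    where
    open ≡-Reasoning
    t : ℕ
    t = (ℓ + r) ∸ j
    shuffle₁ : ∀ a b c d → a + b + c + d ≡ (a + d) + (c + b)
    shuffle₁ = solve-∀
    shuffle₂ : ∀ a b c → (a + b) + (c + b) ≡ a + (c + b * 2)
    shuffle₂ = solve-∀
    rearrange : yHead ℓ + x + r ≡ j + (x + t * 2)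
    rearrange = begin
      ℓ + t + x + r       ≡⟨ shuffle₁ ℓ t x r ⟩
      (ℓ + r) + (x + t)   ≡⟨ cong (_+ (x + t)) (m+[n∸m]≡n j≤ℓ+r) ⟨
      (j + t) + (x + t)   ≡⟨ shuffle₂ j t x ⟩
      j + (x + t * 2)     ∎

  module _ (k : ℕ) (r≤k : r ≤ k) where

    shifted-bound⇔ : ∀ ℓ x → ℓ + (ℓ + x) ≤ j + (k ∸ r) ⇔ (ℓ + x) + (ℓ + r) ≤ k + j
    shifted-bound⇔ ℓ x = mk⇔
      (λ le → subst₂ _≤_ lhs≡ rhs≡ (+-monoˡ-≤ r le))
      (λ le → +-cancelʳ-≤ r _ _ (subst₂ _≤_ (sym lhs≡) (sym rhs≡) le))
      where
      shuffle : ∀ a b c → a + (a + b) + c ≡ (a + b) + (a + c)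
      shuffle = solve-∀
      lhs≡ : ℓ + (ℓ + x) + r ≡ (ℓ + x) + (ℓ + r)
      lhs≡ = shuffle ℓ x r
      rhs≡ : j + (k ∸ r) + r ≡ k + j
      rhs≡ = trans (+-assoc j (k ∸ r) r) (trans (cong (j +_) (m∸n+n≡m r≤k)) (+-comm j k))

    yBound⇒zBound : ∀ {ℓ x} → ℓ ≤ j → yHead ℓ + x ≤ k →
      ℓ + ((ℓ + x) ∸ (k ∸ r)) ≤ j
    yBound⇒zBound {ℓ} {x} ℓ≤j le =
      from (m+[n∸o]≤p⇔ ℓ (ℓ + x) (k ∸ r) j) (ℓ≤j , from (shifted-bound⇔ ℓ x) doubled)
      where
      doubled : (ℓ + x) + (ℓ + r) ≤ k + j
      doubled = proj₂ (to (m+[n∸o]≤p⇔ (ℓ + x) (ℓ + r) j k) (subst (_≤ k) (yHead+x≡ ℓ x) le))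

    zBound⇒yBound : ∀ {ℓ x} → ℓ + x ≤ k → ℓ + ((ℓ + x) ∸ (k ∸ r)) ≤ j →
      yHead ℓ + x ≤ k
    zBound⇒yBound {ℓ} {x} ℓ+x≤k le = subst (_≤ k) (sym (yHead+x≡ ℓ x))
      (from (m+[n∸o]≤p⇔ (ℓ + x) (ℓ + r) j k) (ℓ+x≤k , to (shifted-bound⇔ ℓ x) doubled))
      where
      doubled : ℓ + (ℓ + x) ≤ j + (k ∸ r)
      doubled = proj₂ (to (m+[n∸o]≤p⇔ ℓ (ℓ + x) (k ∸ r) j) le)

    private
      Y = Σ FreqSeq (InY j r k)
      Z = Σ FreqSeq (InZ j r k)

    headIndex : Y → ℕ
    headIndex (_ , _ , (ℓ , _) , _) = ℓ

    seq₀≡yHead-headIndex : ∀ y → seq (proj₁ y) 0 ≡ yHead (headIndex y)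
    seq₀≡yHead-headIndex (_ , _ , (_ , _ , f₀≡) , _) = f₀≡

    toZ : Y → Z
    toZ (f , bounded , (ℓ , ℓ≤j , f₀≡) , parity) =
      withHead ℓ f , bounded′ , yBound⇒zBound ℓ≤j yBound , parity′
      where
      yBound : yHead ℓ + seq f 1 ≤ k
      yBound = subst (λ z → z + seq f 1 ≤ k) f₀≡ (bounded 0)
      bounded′ : SumBound k (withHead ℓ f)
      bounded′ zero    = ≤-trans (+-monoˡ-≤ (seq f 1) (m≤m+n ℓ _)) yBound
      bounded′ (suc i) = bounded (suc i)
      parity′ : ParityCond j r k (withHead ℓ f)
      parity′ zero    ℓ+f₁≡k = parity 0 (trans (cong (_+ seq f 1) f₀≡ℓ) ℓ+f₁≡k)
        where
        f₀≡ℓ : seq f 0 ≡ ℓ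
        f₀≡ℓ = trans f₀≡ (yHead+x≤ℓ+x⇒yHead≡id (subst (_ ≤_) (sym ℓ+f₁≡k) yBound))
      parity′ (suc u) = parity (suc u)

    toY : Z → Y
    toY (g , bounded , zBound , parity) =
      withHead (yHead ℓ) g , bounded′ , (ℓ , m+n≤o⇒m≤o ℓ zBound , refl) , parity′
      where
      ℓ = seq g 0
      bounded′ : SumBound k (withHead (yHead ℓ) g)
      bounded′ zero    = zBound⇒yBound (bounded 0) zBound
      bounded′ (suc i) = bounded (suc i)
      parity′ : ParityCond j r k (withHead (yHead ℓ) g)
      parity′ zero f₀+g₁≡k with ≤-total (ℓ + r) j
      ... | inj₁ ℓ+r≤j = parity 0 (trans (cong (_+ seq g 1) (sym (yHead≡id ℓ+r≤j))) f₀+g₁≡k)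
      ... | inj₂ j≤ℓ+r = trans (cong (_% 2) (+-identityʳ (seq g 1)))
                               (yHead+x-parity j≤ℓ+r f₀+g₁≡k)
      parity′ (suc u) = parity (suc u)

    size-toZ : ∀ y → size (proj₁ (toZ y)) ≡ size (proj₁ y)
    size-toZ (f , _ , (ℓ , _) , _) = size-withHead ℓ f

    toZ-inverse : Inverse (𝒴' j r k) (𝒵' j r k)
    toZ-inverse = record
      { to        = toZ
      ; from      = toY
      ; to-cong   = λ {y} {y′} → toZ-cong {y} {y′}
      ; from-cong = λ {z} {z′} → toY-cong {z} {z′}
      ; inverse   = (λ {z} {y} → toZ-toY {z} {y}) , (λ {y} {z} → toY-toZ {y} {z})
      }
      where
      toZ-cong : ∀ {y y′ : Y} → proj₁ y ≈F proj₁ y′ → proj₁ (toZ y) ≈F proj₁ (toZ y′)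
      toZ-cong {y} {y′} y≈y′ zero = yHead-injective
        (trans (sym (seq₀≡yHead-headIndex y)) (trans (y≈y′ 0) (seq₀≡yHead-headIndex y′)))
      toZ-cong y≈y′ (suc i) = y≈y′ (suc i)
      toY-cong : ∀ {z z′ : Z} → proj₁ z ≈F proj₁ z′ → proj₁ (toY z) ≈F proj₁ (toY z′)
      toY-cong z≈z′ zero    = cong yHead (z≈z′ 0)
      toY-cong z≈z′ (suc i) = z≈z′ (suc i)
      toZ-toY : ∀ {z : Z} {y : Y} → proj₁ y ≈F proj₁ (toY z) → proj₁ (toZ y) ≈F proj₁ z
      toZ-toY {y = y} y≈ zero = yHead-injective (trans (sym (seq₀≡yHead-headIndex y)) (y≈ 0))
      toZ-toY y≈ (suc i) = y≈ (suc i)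
      toY-toZ : ∀ {y : Y} {z : Z} → proj₁ z ≈F proj₁ (toZ y) → proj₁ (toY z) ≈F proj₁ y
      toY-toZ {y} z≈ zero = trans (cong yHead (z≈ 0)) (sym (seq₀≡yHead-headIndex y))
      toY-toZ z≈ (suc i) = z≈ (suc i)

proposition7p8 : (j r k : ℕ) → j + r ≤ k →
    Σ (Bijection (𝒴' j r k) (𝒵' j r k)) λ φ →
      ∀ y → size (proj₁ (Bijection.to φ y)) ≡ size (proj₁ y)
proposition7p8 j r k j+r≤k = Inverse⇒Bijection (toZ-inverse j r k r≤k) , size-toZ j r k r≤k
  where
  r≤k : r ≤ k
  r≤k = m+n≤o⇒n≤o j j+r≤k
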